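{- Let $\mathbf{P}=P\Delta$, $T$ and a rewrite system $R=(R_T,R_P)$ be as below, and suppose $\to_R$ is Noetherian (there is no infinite chain $t_1\to_R t_2\to_R\cdots$). Suppose that, for every ordered pair of rules of $R$ and every overlap of the following kinds, the associated pair resolves: (i) $(s_1,u_1),(s_2,u_2)\in R_T$ with $s_2=s_1\cdot q$ for some arrow $q$: the pair $(u_1\cdot q,u_2)$ in $T$; (ii) $(l_1,r_1),(l_2,r_2)\in R_P$ with $l_1=pl_2q$ for some arrows $p,q$: the pair of arrows $(r_1,pr_2q)$; (iii) $(l_1,r_1),(l_2,r_2)\in R_P$ with $l_1q=pl_2$ for some arrows $p,q$: the pair of arrows $(r_1q,pr_2)$; (iv) $(s_1,u_1)\in R_T$, $(l_1,r_1)\in R_P$ with $s_1\cdot q=s\cdot l_1$ for some $s\in T$ and arrow $q$: the pair $(u_1\cdot q,s\cdot r_1)$ in $T$; (v) $(s_1,u_1)\in R_T$, $(l_1,r_1)\in R_P$ with $s_1=s\cdot(l_1q)$ for some $s\in T$ and arrow $q$: the pair $(u_1,s\cdot r_1q)$ in $T$. Then every critical pair of $\to_R$ resolves (i.e. whenever $t\to_R t_1$ and $t\to_R t_2$ there is $t'$ with $t_1\stackrel{*}{\to}_R t'$ and $t_2\stackrel{*}{\to}_R t'$), and $\to_R$ is confluent.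
   Context: $\Gamma,\Delta$ are directed graphs; $X$ assigns a set $XA$ to each object $A$ of $\Gamma$; $F$ assigns an object $FA$ of $\Delta$ to each object $A$ of $\Gamma$. $\mathbf{P}=P\Delta$ is the free category on $\Delta$ (composition by juxtaposition, diagrammatic order; arrows may be identities). $T=\bigsqcup_{B\in\mathrm{ob}\,\Delta}\bigsqcup_{A\in\mathrm{ob}\,\Gamma}XA\times\mathbf{P}(FA,B)$, elements $x|p$, $\tau(x|p)=\mathrm{tgt}(p)$, $(x|p)\cdot q=x|pq$ when $\mathrm{src}(q)=\tau(x|p)$. A rewrite system is $R=(R_T,R_P)$ with $R_T\subseteq T\times T$ satisfying $\tau(s)=\tau(u)$ for $(s,u)\in R_T$, and $R_P$ a set of pairs of parallel arrows of $\mathbf{P}$. $t_1\to_R t_2$ iff either $t_1=s\cdot q$, $t_2=u\cdot q$ for some $(s,u)\in R_T$ and arrow $q$, or $t_1=s\cdot(lq)$, $t_2=s\cdot(rq)$ for some $(l,r)\in R_P$, $s\in T$, arrow $q$; $\stackrel{*}{\to}_R$ is its reflexive transitive closure. A pair $(t_1,t_2)$ of terms resolves if there is $t'$ with $t_1\stackrel{*}{\to}_R t'$ and $t_2\stackrel{*}{\to}_R t'$. A pair $(p_1,p_2)$ of parallel arrows resolves if there is an arrow $w$ with $p_1\stackrel{*}{\to} w$ and $p_2\stackrel{*}{\to} w$, where on arrows $ulv\to urv$ for $(l,r)\in R_P$. Confluent: whenever $t\stackrel{*}{\to}_R t_1$ and $t\stackrel{*}{\to}_R t_2$, the pair $(t_1,t_2)$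 resolves. -}

module Defs where

open import Data.Product using (Σ; ∃; _×_; _,_)
open import Data.Sum using (_⊎_)
open import Relation.Binary.PropositionalEquality using (_≡_)
open import Relation.Binary.Construct.Closure.ReflexiveTransitive
  using (Star; ε; _◅_; _◅◅_) public

record Graph : Set₁ where
  field
    Ob  : Set
    Hom : Ob → Ob → Set

-- The free category PΔ: arrows a → b are paths (possibly empty = identity),
-- composition is concatenation _◅◅_ in diagrammatic order.
Path : (Δ : Graph) → Graph.Ob Δ → Graph.Ob Δ → Set
Path Δ = Star (Graph.Hom Δ)

module Rewriting (Γ Δ : Graph)
                 (X : Graph.Ob Γ → Set)
                 (F : Graph.Ob Γ → Graph.Ob Δ) where

  open Graph

  P : Ob Δ → Ob Δ → Set
  P = Path Δ

  -- Term B : the elements x|p of T with τ(x|p) = B.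
  data Term (B : Ob Δ) : Set where
    _∣_ : {A : Ob Γ} → X A → P (F A) B → Term B

  T : Set
  T = Σ (Ob Δ) Term

  _·_ : {B C : Ob Δ} → Term B → P B C → Term C
  (x ∣ p) · q = x ∣ (p ◅◅ q)

  RelT : Set₁
  RelT = {B : Ob Δ} → Term B → Term B → Set

  RelP : Set₁
  RelP = {a b : Ob Δ} → P a b → P a b → Set

  module _ (RT : RelT) (RP : RelP) where

    data Step {B : Ob Δ} (t₁ t₂ : Term B) : Set where
      stepT : {C : Ob Δ} (s u : Term C) → RT s u → (q : P C B) →
              t₁ ≡ s · q → t₂ ≡ u · q → Step t₁ t₂
      stepP : {C D : Ob Δ} (s : Term C) (l r : P C D) → RP l r → (q : P D B) →
              t₁ ≡ s · (l ◅◅ q) → t₂ ≡ s · (r ◅◅ q) → Step t₁ t₂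

    Steps : {B : Ob Δ} → Term B → Term B → Set
    Steps = Star Step

    Resolves : {B : Ob Δ} → Term B → Term B → Set
    Resolves t₁ t₂ = ∃ λ t′ → Steps t₁ t′ × Steps t₂ t′

    data ArrStep {a b : Ob Δ} (p₁ p₂ : P a b) : Set where
      arrStep : {c d : Ob Δ} (u : P a c) (l r : P c d) (v : P d b) → RP l r →
                p₁ ≡ u ◅◅ (l ◅◅ v) → p₂ ≡ u ◅◅ (r ◅◅ v) → ArrStep p₁ p₂

    ArrSteps : {a b : Ob Δ} → P a b → P a b → Set
    ArrSteps = Star ArrStep

    ResolvesArr : {a b : Ob Δ} → P a b → P a b → Set
    ResolvesArr p₁ p₂ = ∃ λ w → ArrSteps p₁ w × ArrSteps p₂ w

    -- Noetherian: no infinite forward chain, rendered constructively as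
    -- well-foundedness of the converse of →_R (on each Term B; chains
    -- preserve τ).
    data Acc {B : Ob Δ} (t : Term B) : Set where
      acc : (∀ {t′} → Step t t′ → Acc t′) → Acc t

    Noetherian : Set
    Noetherian = {B : Ob Δ} (t : Term B) → Acc t

    CondI : Set
    CondI = {C₁ C₂ : Ob Δ} (s₁ u₁ : Term C₁) (s₂ u₂ : Term C₂) →
            RT s₁ u₁ → RT s₂ u₂ → (q : P C₁ C₂) →
            s₂ ≡ s₁ · q → Resolves (u₁ · q) u₂

    CondII : Set
    CondII = {a b c d : Ob Δ} (l₁ r₁ : P a b) (l₂ r₂ : P c d) →
             RP l₁ r₁ → RP l₂ r₂ → (p : P a c) (q : P d b) →
             l₁ ≡ p ◅◅ (l₂ ◅◅ q) → ResolvesArr r₁ (p ◅◅ (r₂ ◅◅ q))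

    CondIII : Set
    CondIII = {a b c d : Ob Δ} (l₁ r₁ : P a b) (l₂ r₂ : P c d) →
              RP l₁ r₁ → RP l₂ r₂ → (p : P a c) (q : P b d) →
              l₁ ◅◅ q ≡ p ◅◅ l₂ → ResolvesArr (r₁ ◅◅ q) (p ◅◅ r₂)

    CondIV : Set
    CondIV = {C a b : Ob Δ} (s₁ u₁ : Term C) (l₁ r₁ : P a b) →
             RT s₁ u₁ → RP l₁ r₁ → (s : Term a) (q : P C b) →
             s₁ · q ≡ s · l₁ → Resolves (u₁ · q) (s · r₁)

    CondV : Set
    CondV = {C a b : Ob Δ} (s₁ u₁ : Term C) (l₁ r₁ : P a b) →
            RT s₁ u₁ → RP l₁ r₁ → (s : Term a) (q : P b C) →
            s₁ ≡ s · (l₁ ◅◅ q) → Resolves u₁ (s · (r₁ ◅◅ q))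

    CriticalPairsResolve : Set
    CriticalPairsResolve = {B : Ob Δ} (t t₁ t₂ : Term B) →
                           Step t t₁ → Step t t₂ → Resolves t₁ t₂

    Confluent : Set
    Confluent = {B : Ob Δ} (t t₁ t₂ : Term B) →
                Steps t t₁ → Steps t t₂ → Resolves t₁ t₂

{-# OPTIONS --safe #-}
-- By Newman's lemma it suffices to resolve every local peak t₁ ← t → t₂.
-- Paths in a free category are equidivisible: if u q = u′ q′ then u′ = u m and
-- q = m q′ for some m, or symmetrically. Applied to the positions of the two
-- redexes this shows that they are either disjoint, and the steps commute, or
-- form one of the overlaps (i)–(v) inside a context; joinability is preserved
-- by contexts, so such peaks resolve by hypothesis. Two R_P-steps on a term
-- x|p are just two rewrites of the arrow p.
module Submission where

open import Defs
open import Data.Product using (Σ; ∃; _×_; _,_; map₂; swap)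
open import Data.Sum using (_⊎_; inj₁; inj₂)
open import Function using (flip; Equivalence)
import Induction.WellFounded as WF
open import Relation.Binary.Core using (Rel; _=[_]⇒_)
open import Relation.Binary.PropositionalEquality using (_≡_; refl; sym; trans; cong; subst₂)
open import Relation.Binary.Construct.Closure.ReflexiveTransitive using (gmap)
open import Relation.Binary.Construct.Closure.ReflexiveTransitive.Properties using (◅◅-assoc)
open import Relation.Binary.Construct.Closure.Transitive
  using (Plus; TransClosure; [_]; _∼⁺⟨_⟩_; equivalent)
  renaming (accessible to accessible⁺)
open import Relation.Binary.Rewriting using (StronglyNormalizing; WeaklyConfluent; sn&wcr⇒cr)

module _ {a b ℓ₁ ℓ₂} {A : Set a} {B : Set b} {R : Rel A ℓ₁} {S : Rel B ℓ₂}
         (f : A → B) (f-preserves : R =[ f ]⇒ S) where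

  joinable-map : ∀ {x y} → (∃ λ z → Star R x z × Star R y z) →
                 ∃ λ z → Star S (f x) z × Star S (f y) z
  joinable-map (z , x↠z , y↠z) = f z , gmap f f-preserves x↠z , gmap f f-preserves y↠z

module _ {a ℓ} {A : Set a} {R : Rel A ℓ} where

  Plus-flip : ∀ {x y} → Plus R x y → Plus (flip R) y x
  Plus-flip [ x⟶y ]           = [ x⟶y ]
  Plus-flip (_ ∼⁺⟨ x⟶⁺y ⟩ y⟶⁺z) = _ ∼⁺⟨ Plus-flip y⟶⁺z ⟩ Plus-flip x⟶⁺y

  StronglyNormalizing-Plus : StronglyNormalizing R → StronglyNormalizing (Plus R)
  StronglyNormalizing-Plus sn x = accessible (accessible⁺ (flip R) (sn x))
    where
    open WF.Subrelation {_<₁_ = flip (Plus R)} {_<₂_ = TransClosure (flip R)}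
                        (λ y⟶⁺x → Equivalence.to equivalent (Plus-flip y⟶⁺x))

module _ {i t} {I : Set i} {T : Rel I t} where

  ◅-injective : ∀ {x y y′ z} {e : T x y} {e′ : T x y′} {xs : Star T y z} {ys : Star T y′ z} →
                e ◅ xs ≡ e′ ◅ ys → Σ (y ≡ y′) λ where refl → e ≡ e′ × xs ≡ ys
  ◅-injective refl = refl , refl , refl

  ◅◅-equidivisible : ∀ {x y y′ z} (u : Star T x y) (q : Star T y z)
                     (u′ : Star T x y′) (q′ : Star T y′ z) →
                     u ◅◅ q ≡ u′ ◅◅ q′ →
                     (Σ (Star T y y′) λ m → u′ ≡ u ◅◅ m × q ≡ m ◅◅ q′) ⊎
                     (Σ (Star T y′ y) λ m → u ≡ u′ ◅◅ m × q′ ≡ m ◅◅ q)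
  ◅◅-equidivisible ε       q u′       q′ uq≡u′q′ = inj₁ (u′ , refl , uq≡u′q′)
  ◅◅-equidivisible (e ◅ u) q ε        q′ uq≡u′q′ = inj₂ (e ◅ u , refl , sym uq≡u′q′)
  ◅◅-equidivisible (e ◅ u) q (e′ ◅ u′) q′ uq≡u′q′ with ◅-injective uq≡u′q′
  ... | refl , refl , tails≡ with ◅◅-equidivisible u q u′ q′ tails≡
  ...   | inj₁ (m , refl , q≡mq′) = inj₁ (m , refl , q≡mq′)
  ...   | inj₂ (m , refl , q′≡mq) = inj₂ (m , refl , q′≡mq)

module Confluence (Γ Δ : Graph) (X : Graph.Ob Γ → Set) (F : Graph.Ob Γ → Graph.Ob Δ)
                  (RT : Rewriting.RelT Γ Δ X F) (RP : Rewriting.RelP Γ Δ X F) where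

  open Graph
  open Rewriting Γ Δ X F

  ∣-injective : ∀ {B A A′} {x : X A} {x′ : X A′} {p : P (F A) B} {p′ : P (F A′) B} →
                x ∣ p ≡ x′ ∣ p′ → Σ (A ≡ A′) λ where refl → x ≡ x′ × p ≡ p′
  ∣-injective refl = refl , refl , refl

  ·-assoc : ∀ {B C D} (t : Term B) (p : P B C) (q : P C D) → (t · p) · q ≡ t · (p ◅◅ q)
  ·-assoc (x ∣ a) p q = cong (x ∣_) (◅◅-assoc a p q)

  ·-equidivisible : ∀ {B C C′} (s : Term C) (q : P C B) (s′ : Term C′) (q′ : P C′ B) →
                    s · q ≡ s′ · q′ →
                    (Σ (P C C′) λ m → s′ ≡ s · m × q ≡ m ◅◅ q′) ⊎
                    (Σ (P C′ C) λ m → s ≡ s′ · m × q′ ≡ m ◅◅ q)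
  ·-equidivisible (x ∣ a) q (x′ ∣ a′) q′ sq≡s′q′ with ∣-injective sq≡s′q′
  ... | refl , refl , aq≡a′q′ with ◅◅-equidivisible a q a′ q′ aq≡a′q′
  ...   | inj₁ (m , refl , q≡mq′) = inj₁ (m , refl , q≡mq′)
  ...   | inj₂ (m , refl , q′≡mq) = inj₂ (m , refl , q′≡mq)

  Step-· : ∀ {B C} (q : P B C) → Step RT RP =[ _· q ]⇒ Step RT RP
  Step-· q (stepT s u s↦u q′ refl refl) =
    stepT s u s↦u (q′ ◅◅ q) (·-assoc s q′ q) (·-assoc u q′ q)
  Step-· q (stepP {C} {D} s l r l↦r q′ refl refl) =
    stepP s l r l↦r (q′ ◅◅ q) (reassoc l) (reassoc r)
    where
    reassoc : (p : P C D) → (s · (p ◅◅ q′)) · q ≡ s · (p ◅◅ (q′ ◅◅ q))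
    reassoc p = trans (·-assoc s (p ◅◅ q′) q) (cong (s ·_) (◅◅-assoc p q′ q))

  resolves-· : ∀ {B C} {t₁ t₂ : Term B} (q : P B C) →
               Resolves RT RP t₁ t₂ → Resolves RT RP (t₁ · q) (t₂ · q)
  resolves-· q = joinable-map (_· q) (Step-· q)

  ArrStep-◅◅ˡ : ∀ {a b c} (w : P a b) → ArrStep RT RP {b} {c} =[ w ◅◅_ ]⇒ ArrStep RT RP
  ArrStep-◅◅ˡ w (arrStep u l r v l↦r refl refl) =
    arrStep (w ◅◅ u) l r v l↦r (sym (◅◅-assoc w u _)) (sym (◅◅-assoc w u _))

  ArrStep-◅◅ʳ : ∀ {a b c} (w : P b c) → ArrStep RT RP {a} {b} =[ _◅◅ w ]⇒ ArrStep RT RP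
  ArrStep-◅◅ʳ w (arrStep {c} {d} u l r v l↦r refl refl) =
    arrStep u l r (v ◅◅ w) l↦r (reassoc l) (reassoc r)
    where
    reassoc : (p : P c d) → (u ◅◅ (p ◅◅ v)) ◅◅ w ≡ u ◅◅ (p ◅◅ (v ◅◅ w))
    reassoc p = trans (◅◅-assoc u (p ◅◅ v) w) (cong (u ◅◅_) (◅◅-assoc p v w))

  ArrStep⇒Step : ∀ {A B} (x : X A) → ArrStep RT RP {F A} {B} =[ x ∣_ ]⇒ Step RT RP
  ArrStep⇒Step x (arrStep u l r v l↦r refl refl) = stepP (x ∣ u) l r l↦r v refl refl

  module ArrowOverlaps (condII : CondII RT RP) (condIII : CondIII RT RP) where

    -- Either l ends before l′ starts, or l′ lies inside l (ii), or a suffix of l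
    -- is a prefix of l′ (iii).
    redexes-resolve : ∀ {a b c d e} {l r : P a b} {l′ r′ : P c d}
                      (m : P a c) (v : P b e) (v′ : P d e) → RP l r → RP l′ r′ →
                      l ◅◅ v ≡ m ◅◅ (l′ ◅◅ v′) → ResolvesArr RT RP (r ◅◅ v) (m ◅◅ (r′ ◅◅ v′))
    redexes-resolve {l = l} {r} {l′} {r′} m v v′ l↦r l′↦r′ lv≡ml′v′
      with ◅◅-equidivisible l v m (l′ ◅◅ v′) lv≡ml′v′
    ... | inj₁ (n , refl , refl) =
      r ◅◅ (n ◅◅ (r′ ◅◅ v′)) ,
      ArrStep-◅◅ˡ r (ArrStep-◅◅ˡ n (arrStep ε l′ r′ v′ l′↦r′ refl refl)) ◅ ε ,
      arrStep ε l r (n ◅◅ (r′ ◅◅ v′)) l↦r (◅◅-assoc l n _) refl ◅ ε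
    ... | inj₂ (k , refl , l′v′≡kv) with ◅◅-equidivisible l′ v′ k v l′v′≡kv
    ...   | inj₁ (j , refl , refl) =
      subst₂ (ResolvesArr RT RP) refl
        (trans (◅◅-assoc m (r′ ◅◅ j) v) (cong (m ◅◅_) (◅◅-assoc r′ j v)))
        (joinable-map (_◅◅ v) (ArrStep-◅◅ʳ v)
          (condII (m ◅◅ (l′ ◅◅ j)) r l′ r′ l↦r l′↦r′ m j refl))
    ...   | inj₂ (j , refl , refl) =
      subst₂ (ResolvesArr RT RP) (◅◅-assoc r j v′) (◅◅-assoc m r′ v′)
        (joinable-map (_◅◅ v′) (ArrStep-◅◅ʳ v′)
          (condIII (m ◅◅ k) r (k ◅◅ j) r′ l↦r l′↦r′ m j (◅◅-assoc m k j)))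

    ArrStep-weaklyConfluent : ∀ {a b} → WeaklyConfluent (ArrStep RT RP {a} {b})
    ArrStep-weaklyConfluent (arrStep u l r v l↦r refl refl)
                            (arrStep u′ l′ r′ v′ l′↦r′ ulv≡u′l′v′ refl)
      with ◅◅-equidivisible u (l ◅◅ v) u′ (l′ ◅◅ v′) ulv≡u′l′v′
    ... | inj₁ (m , refl , lv≡ml′v′) =
      subst₂ (ResolvesArr RT RP) refl (sym (◅◅-assoc u m _))
        (joinable-map (u ◅◅_) (ArrStep-◅◅ˡ u) (redexes-resolve m v v′ l↦r l′↦r′ lv≡ml′v′))
    ... | inj₂ (m , refl , l′v′≡mlv) =
      map₂ swap (subst₂ (ResolvesArr RT RP) refl (sym (◅◅-assoc u′ m _))
        (joinable-map (u′ ◅◅_) (ArrStep-◅◅ˡ u′) (redexes-resolve m v′ v l′↦r′ l↦r l′v′≡mlv)))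

  module TermOverlaps (condI : CondI RT RP) (condIV : CondIV RT RP) (condV : CondV RT RP) where

    RT-RT-resolves : ∀ {B C C′} {s u : Term C} {s′ u′ : Term C′} (q : P C B) (q′ : P C′ B) →
                     RT s u → RT s′ u′ → s · q ≡ s′ · q′ → Resolves RT RP (u · q) (u′ · q′)
    RT-RT-resolves {s = s} {u} {s′} {u′} q q′ s↦u s′↦u′ sq≡s′q′
      with ·-equidivisible s q s′ q′ sq≡s′q′
    ... | inj₁ (m , refl , refl) =
      subst₂ (Resolves RT RP) (·-assoc u m q′) refl
        (resolves-· q′ (condI s u (s · m) u′ s↦u s′↦u′ m refl))
    ... | inj₂ (m , refl , refl) =
      map₂ swap (subst₂ (Resolves RT RP) (·-assoc u′ m q) refl
        (resolves-· q (condI s′ u′ (s′ · m) u s′↦u′ s↦u m refl)))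

    RT-RP-resolves : ∀ {B C a b} {s u : Term C} {l r : P a b}
                     (q : P C B) (s′ : Term a) (q′ : P b B) → RT s u → RP l r →
                     s · q ≡ s′ · (l ◅◅ q′) → Resolves RT RP (u · q) (s′ · (r ◅◅ q′))
    RT-RP-resolves {s = s} {u} {l} {r} q s′ q′ s↦u l↦r sq≡s′lq′
      with ·-equidivisible s q (s′ · l) q′ (trans sq≡s′lq′ (sym (·-assoc s′ l q′)))
    ... | inj₁ (m , s′l≡sm , refl) =
      subst₂ (Resolves RT RP) (·-assoc u m q′) (·-assoc s′ r q′)
        (resolves-· q′ (condIV s u l r s↦u l↦r s′ m (sym s′l≡sm)))
    ... | inj₂ (m , refl , refl) =
      subst₂ (Resolves RT RP) refl
        (trans (·-assoc s′ (r ◅◅ m) q) (cong (s′ ·_) (◅◅-assoc r m q)))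
        (resolves-· q (condV ((s′ · l) · m) u l r s↦u l↦r s′ m (·-assoc s′ l m)))

  module _ (condI : CondI RT RP) (condII : CondII RT RP) (condIII : CondIII RT RP)
           (condIV : CondIV RT RP) (condV : CondV RT RP) where
    open ArrowOverlaps condII condIII
    open TermOverlaps condI condIV condV

    Step-weaklyConfluent : ∀ {B} → WeaklyConfluent (Step RT RP {B})
    Step-weaklyConfluent (stepT _ _ s↦u q refl refl) (stepT _ _ s′↦u′ q′ sq≡s′q′ refl) =
      RT-RT-resolves q q′ s↦u s′↦u′ sq≡s′q′
    Step-weaklyConfluent (stepT _ _ s↦u q refl refl) (stepP s′ _ _ l↦r q′ sq≡s′lq′ refl) =
      RT-RP-resolves q s′ q′ s↦u l↦r sq≡s′lq′
    Step-weaklyConfluent (stepP s′ _ _ l↦r q′ refl refl) (stepT _ _ s↦u q sq≡s′lq′ refl) =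
      map₂ swap (RT-RP-resolves q s′ q′ s↦u l↦r (sym sq≡s′lq′))
    Step-weaklyConfluent (stepP (x ∣ a) l r l↦r q refl refl)
                         (stepP (x′ ∣ a′) l′ r′ l′↦r′ q′ alq≡a′l′q′ refl)
      with ∣-injective alq≡a′l′q′
    ... | refl , refl , alq≡a′l′q′ =
      joinable-map (x ∣_) (ArrStep⇒Step x)
        (ArrStep-weaklyConfluent (arrStep a l r q l↦r refl refl)
                                 (arrStep a′ l′ r′ q′ l′↦r′ alq≡a′l′q′ refl))

  Noetherian⇒StronglyNormalizing : Noetherian RT RP → ∀ {B} → StronglyNormalizing (Step RT RP {B})
  Noetherian⇒StronglyNormalizing noetherian t = fromAcc (noetherian t)
    where
    fromAcc : ∀ {B} {t : Term B} → Acc RT RP t → WF.Acc (flip (Step RT RP)) t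
    fromAcc (acc rs) = WF.acc λ t⟶t′ → fromAcc (rs t⟶t′)

mainTheorem4 : (Γ Δ : Graph) (X : Graph.Ob Γ → Set) (F : Graph.Ob Γ → Graph.Ob Δ)
    (RT : Rewriting.RelT Γ Δ X F) (RP : Rewriting.RelP Γ Δ X F) →
    Rewriting.Noetherian Γ Δ X F RT RP →
    Rewriting.CondI Γ Δ X F RT RP →
    Rewriting.CondII Γ Δ X F RT RP →
    Rewriting.CondIII Γ Δ X F RT RP →
    Rewriting.CondIV Γ Δ X F RT RP →
    Rewriting.CondV Γ Δ X F RT RP →
    Rewriting.CriticalPairsResolve Γ Δ X F RT RP × Rewriting.Confluent Γ Δ X F RT RP
mainTheorem4 Γ Δ X F RT RP noetherian condI condII condIII condIV condV =
  (λ _ _ _ → weaklyConfluent) ,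
  (λ _ _ _ → sn&wcr⇒cr {_⟶_ = Step RT RP} stronglyNormalizing⁺ weaklyConfluent)
  where
  open Confluence Γ Δ X F RT RP
  open Rewriting Γ Δ X F

  weaklyConfluent : ∀ {B} → WeaklyConfluent (Step RT RP {B})
  weaklyConfluent = Step-weaklyConfluent condI condII condIII condIV condV

  stronglyNormalizing⁺ : ∀ {B} → StronglyNormalizing (Plus (Step RT RP {B}))
  stronglyNormalizing⁺ = StronglyNormalizing-Plus (Noetherian⇒StronglyNormalizing noetherian)
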